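{- Let $\mathcal{C}\subseteq\mathbb{S}_n$ be a code and suppose that $\mathrm{d}_\mathrm{K}(\mathcal{C})>\binom{t}{2}$ for some $t\in[n]$. Then $|\mathcal{C}|\le \frac{n!}{t!}$.
   Context: $\mathbb{S}_n$ is the group of permutations of $[n]=\{1,\dots,n\}$, written in one-line notation. The Kendall-$\tau$ distance $\mathrm{d}_\mathrm{K}(\sigma,\tau)$ is the minimum number of adjacent transpositions (swaps of two consecutive entries in one-line notation) needed to obtain $\sigma$ from $\tau$. A code is a subset $\mathcal{C}\subseteq\mathbb{S}_n$ with $|\mathcal{C}|\ge 2$; its minimum distance is $\mathrm{d}_\mathrm{K}(\mathcal{C})=\min\{\mathrm{d}_\mathrm{K}(\sigma,\tau):\sigma,\tau\in\mathcal{C},\ \sigma\neq\tau\}$. -}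

module Defs where

open import Data.Nat using (ℕ; zero; suc; _<_)
open import Data.Fin using (Fin)
open import Data.Vec using (Vec; []; _∷_)
open import Data.List using (List)
open import Data.List.Membership.Propositional using (_∈_)
open import Data.Product using (Σ; _×_)
open import Relation.Binary.PropositionalEquality using (_≡_; _≢_)
open import Relation.Nullary using (¬_)
import Data.Vec
import Data.Nat
import Data.List
import Data.List.Relation.Unary.Unique.Propositional

-- A permutation of [n] = {1..n} in one-line notation, with [n] modelled by Fin n:
-- a vector of length n whose entries are pairwise distinct (hence a bijection).
IsPerm : {n : ℕ} → Vec (Fin n) n → Set
IsPerm {n} σ = (i j : Fin n) → Data.Vec.lookup σ i ≡ Data.Vec.lookup σ j → i ≡ j

data AdjSwap {A : Set} : {m : ℕ} → Vec A m → Vec A m → Set where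
  here  : {m : ℕ} {x y : A} {v : Vec A m} → AdjSwap (x ∷ y ∷ v) (y ∷ x ∷ v)
  there : {m : ℕ} {x : A} {v w : Vec A m} → AdjSwap v w → AdjSwap (x ∷ v) (x ∷ w)

data SwapSeq {A : Set} {m : ℕ} : ℕ → Vec A m → Vec A m → Set where
  done : {v : Vec A m} → SwapSeq zero v v
  step : {k : ℕ} {u v w : Vec A m} → AdjSwap u v → SwapSeq k v w → SwapSeq (suc k) u w

-- d_K(σ,τ) > B : the minimum number of adjacent transpositions needed to obtain σ
-- from τ exceeds B, i.e. every such sequence has length > B.
KDistGt : {n : ℕ} → Vec (Fin n) n → Vec (Fin n) n → ℕ → Set
KDistGt σ τ B = (k : ℕ) → SwapSeq k τ σ → B < k

record Code (n : ℕ) : Set where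
  field
    words    : List (Vec (Fin n) n)
    allPerm  : (σ : Vec (Fin n) n) → σ ∈ words → IsPerm σ
    distinct : Data.List.Relation.Unary.Unique.Propositional.Unique words
    atLeast2 : 2 Data.Nat.≤ Data.List.length words

open Code public

card : {n : ℕ} → Code n → ℕ
card C = Data.List.length (words C)

MinDistGt : {n : ℕ} → Code n → ℕ → Set
MinDistGt C B = (σ τ : _) → σ ∈ words C → τ ∈ words C → σ ≢ τ → KDistGt σ τ B

-- Two permutations with the same last n − t entries differ only by a rearrangement of
-- their first t entries, and bubble sort performs any rearrangement of t distinct
-- entries with at most C(t,2) adjacent swaps.  So distinct codewords of a code with
-- d_K > C(t,2) have distinct suffixes of length n − t.  Such a suffix is a repetition-free
-- word of length n − t over [n], and there are n (n − 1) ⋯ (t + 1) = n!/t! of those.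
module Submission where

open import Defs
open import Data.Nat using (ℕ; zero; suc; _+_; _*_; _∸_; _≤_; z≤n; s≤s; _!; _/_)
open import Data.Nat.Properties
  using (_!≢0; ≤-trans; ≤-reflexive; +-mono-≤; ≤⇒≯; 1+n≰n; *-identityˡ; *-assoc;
         m≤n⇒∃[o]m+o≡n; m+n∸n≡m; m≤n+m; module ≤-Reasoning)
open import Data.Nat.Combinatorics using (_C_; nC1≡n; nCk+nC[k+1]≡[n+1]C[k+1])
open import Data.Nat.DivMod using (m*n/n≡m)
open import Data.Fin using (Fin; zero; suc; toℕ; punchOut; combine; _≟_)
open import Data.Fin.Properties
  using (toℕ≤pred[n]; punchOut-injective; combine-injective; injective⇒≤)
open import Data.Vec using (Vec; []; _∷_; _++_; lookup; insertAt; removeAt; take; drop)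
open import Data.Vec.Properties
  using (∷-injectiveˡ; ∷-injectiveʳ; insertAt-removeAt; take++drop≡id; tabulate∘lookup; ≡-dec)
open import Data.Vec.Relation.Unary.All using (All; []; _∷_)
import Data.Vec.Relation.Unary.All as All
open import Data.Vec.Relation.Unary.AllPairs using ([]; _∷_)
open import Data.Vec.Relation.Unary.Any using (here; there; index; any?)
open import Data.Vec.Relation.Unary.Any.Properties using (lookup-index; ++⁺ʳ; ++⁻)
open import Data.Vec.Membership.Propositional using (_∈_; _∉_)
open import Data.Vec.Membership.Propositional.Properties using (∈-lookup)
open import Data.Vec.Relation.Unary.Unique.Propositional using (Unique)
open import Data.Vec.Relation.Unary.Unique.Propositional.Properties using (take⁺; drop⁺; tabulate⁺)
open import Data.List using (List)
import Data.List as List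
import Data.List.Relation.Unary.All as ListAll
open import Data.List.Relation.Unary.AllPairs using (_∷_)
import Data.List.Relation.Unary.Unique.Propositional as ListUnique
open import Data.List.Membership.Propositional using () renaming (_∈_ to _∈ₗ_)
open import Data.List.Membership.Propositional.Properties using () renaming (∈-lookup to ∈ₗ-lookup)
open import Data.Product using (∃₂; ∃-syntax; _×_; _,_)
open import Data.Sum using (inj₁; inj₂)
open import Function.Definitions using (Injective)
open import Relation.Nullary using (¬_; yes; no; contradiction)
open import Relation.Binary.PropositionalEquality
  using (_≡_; _≢_; refl; sym; trans; cong; cong₂; subst; subst₂; ≢-sym; module ≡-Reasoning)

private
  variable
    A : Set
    k l m n t : ℕ

AdjSwap-++ʳ : {u v : Vec A m} (w : Vec A l) → AdjSwap u v → AdjSwap (u ++ w) (v ++ w)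
AdjSwap-++ʳ w here      = here
AdjSwap-++ʳ w (there s) = there (AdjSwap-++ʳ w s)

SwapSeq-++ʳ : {u v : Vec A m} (w : Vec A l) → SwapSeq k u v → SwapSeq k (u ++ w) (v ++ w)
SwapSeq-++ʳ w done       = done
SwapSeq-++ʳ w (step s r) = step (AdjSwap-++ʳ w s) (SwapSeq-++ʳ w r)

SwapSeq-∷ : {x : A} {v w : Vec A m} → SwapSeq k v w → SwapSeq k (x ∷ v) (x ∷ w)
SwapSeq-∷ done       = done
SwapSeq-∷ (step s r) = step (there s) (SwapSeq-∷ r)

SwapSeq-trans : {u v w : Vec A m} → SwapSeq k u v → SwapSeq l v w → SwapSeq (k + l) u w
SwapSeq-trans done       r = r
SwapSeq-trans (step s q) r = step s (SwapSeq-trans q r)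

SwapSeq-snoc : {u v w : Vec A m} → SwapSeq k u v → AdjSwap v w → SwapSeq (suc k) u w
SwapSeq-snoc done       s = step s done
SwapSeq-snoc (step r q) s = step r (SwapSeq-snoc q s)

KDistLe : Vec A m → Vec A m → ℕ → Set
KDistLe σ τ B = ∃[ k ] k ≤ B × SwapSeq k τ σ

KDistLe⇒¬KDistGt : {σ τ : Vec (Fin n) n} {B : ℕ} → KDistLe σ τ B → ¬ KDistGt σ τ B
KDistLe⇒¬KDistGt (k , k≤B , s) gt = ≤⇒≯ k≤B (gt k s)

KDistLe-++ʳ : {u v : Vec A m} {B : ℕ} (w : Vec A l) → KDistLe u v B → KDistLe (u ++ w) (v ++ w) B
KDistLe-++ʳ w (k , k≤B , s) = k , k≤B , SwapSeq-++ʳ w s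

insertAt-toFront : (v : Vec A m) (i : Fin (suc m)) (x : A) → SwapSeq (toℕ i) (insertAt v i x) (x ∷ v)
insertAt-toFront v       zero    x = done
insertAt-toFront (y ∷ v) (suc i) x = SwapSeq-snoc (SwapSeq-∷ (insertAt-toFront v i x)) here

∈⇒insertAt : {x : A} {v : Vec A (suc m)} → x ∈ v → ∃₂ λ v′ i → v ≡ insertAt v′ i x
∈⇒insertAt {v = v} x∈v =
  removeAt v i , i , trans (sym (insertAt-removeAt v i)) (cong (insertAt _ i) (sym (lookup-index x∈v)))
  where i = index x∈v

∈-insertAt⁻ : {x y : A} (v : Vec A m) (i : Fin (suc m)) → y ∈ insertAt v i x → y ≢ x → y ∈ v
∈-insertAt⁻ v       zero    (here y≡x)  y≢x = contradiction y≡x y≢x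
∈-insertAt⁻ v       zero    (there y∈v) y≢x = y∈v
∈-insertAt⁻ (z ∷ v) (suc i) (here y≡z)  y≢x = here y≡z
∈-insertAt⁻ (z ∷ v) (suc i) (there y∈)  y≢x = there (∈-insertAt⁻ v i y∈ y≢x)

[1+n]C2≡n+nC2 : ∀ n → suc n C 2 ≡ n + n C 2
[1+n]C2≡n+nC2 n = trans (sym (nCk+nC[k+1]≡[n+1]C[k+1] n 1)) (cong (_+ n C 2) (nC1≡n n))

rearrangement-KDistLe : {u v : Vec A t} → Unique u → (∀ {y} → y ∈ u → y ∈ v) → KDistLe u v (t C 2)
rearrangement-KDistLe {u = []} {[]} _ _ = 0 , z≤n , done
rearrangement-KDistLe {t = suc t} {u = x ∷ u} (x∉u ∷ u-unique) u⊆v with ∈⇒insertAt (u⊆v (here refl))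
... | v , i , refl =
  let k , k≤ , s = rearrangement-KDistLe u-unique u⊆v′ in
  toℕ i + k ,
  ≤-trans (+-mono-≤ (toℕ≤pred[n] i) k≤) (≤-reflexive (sym ([1+n]C2≡n+nC2 t))) ,
  SwapSeq-trans (insertAt-toFront v i x) (SwapSeq-∷ s)
  where
  u⊆v′ : ∀ {y} → y ∈ u → y ∈ v
  u⊆v′ y∈u = ∈-insertAt⁻ v i (u⊆v (there y∈u)) (≢-sym (All.lookup x∉u y∈u))

Unique-++-disjoint : {u : Vec A m} {w : Vec A l} {y : A} → Unique (u ++ w) → y ∈ u → y ∉ w
Unique-++-disjoint {u = x ∷ u} (x∉uw ∷ _) (here refl) y∈w = All.lookup x∉uw (++⁺ʳ u y∈w) refl
Unique-++-disjoint (_ ∷ uw-unique) (there y∈u) = Unique-++-disjoint uw-unique y∈u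

isPerm⇒unique : {σ : Vec (Fin n) n} → IsPerm σ → Unique σ
isPerm⇒unique {σ = σ} σ-perm = subst Unique (tabulate∘lookup σ) (tabulate⁺ (σ-perm _ _))

isPerm⇒∈ : {σ : Vec (Fin n) n} → IsPerm σ → (y : Fin n) → y ∈ σ
isPerm⇒∈ {n = suc n} {σ} σ-perm y with any? (y ≟_) σ
... | yes y∈σ = y∈σ
... | no  y∉σ = contradiction (injective⇒≤ {f = punchOut-σ} punched-injective) (1+n≰n {n})
  where
  y≢σ : ∀ i → y ≢ lookup σ i
  y≢σ i y≡σᵢ = y∉σ (subst (_∈ σ) (sym y≡σᵢ) (∈-lookup i σ))
  punchOut-σ : Fin (suc n) → Fin n
  punchOut-σ i = punchOut (y≢σ i)
  punched-injective : Injective _≡_ _≡_ punchOut-σ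
  punched-injective {i} {j} eq = σ-perm i j (punchOut-injective (y≢σ i) (y≢σ j) eq)

sameSuffix⇒KDistLe : (t : ℕ) {σ τ : Vec (Fin (t + m)) (t + m)} → IsPerm σ → IsPerm τ →
                     drop t σ ≡ drop t τ → KDistLe σ τ (t C 2)
sameSuffix⇒KDistLe t {σ} {τ} σ-perm τ-perm same =
  subst₂ (λ σ′ τ′ → KDistLe σ′ τ′ (t C 2)) (sym σ-split) (sym τ-split)
    (KDistLe-++ʳ (drop t σ) (rearrangement-KDistLe (take⁺ t σ-unique) prefix⊆))
  where
  σ-unique : Unique σ
  σ-unique = isPerm⇒unique σ-perm
  σ-split : σ ≡ take t σ ++ drop t σ
  σ-split = sym (take++drop≡id t σ)
  τ-split : τ ≡ take t τ ++ drop t σ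
  τ-split = trans (sym (take++drop≡id t τ)) (cong (take t τ ++_) (sym same))
  prefix⊆ : ∀ {y} → y ∈ take t σ → y ∈ take t τ
  prefix⊆ {y} y∈σ₁ with ++⁻ (take t τ) (subst (y ∈_) τ-split (isPerm⇒∈ τ-perm y))
  ... | inj₁ y∈τ₁ = y∈τ₁
  ... | inj₂ y∈σ₂ = contradiction y∈σ₂ (Unique-++-disjoint (subst Unique σ-split σ-unique) y∈σ₁)

fallingFactorial : ℕ → ℕ → ℕ
fallingFactorial n       zero    = 1
fallingFactorial zero    (suc k) = 0
fallingFactorial (suc n) (suc k) = suc n * fallingFactorial n k

fallingFactorial*[n∸k]!≡n! : k ≤ n → fallingFactorial n k * (n ∸ k) ! ≡ n !
fallingFactorial*[n∸k]!≡n! {zero}  {n}     _           = *-identityˡ (n !)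
fallingFactorial*[n∸k]!≡n! {suc k} {suc n} (s≤s k≤n) = begin
  suc n * fallingFactorial n k * (n ∸ k) !   ≡⟨ *-assoc (suc n) (fallingFactorial n k) ((n ∸ k) !) ⟩
  suc n * (fallingFactorial n k * (n ∸ k) !) ≡⟨ cong (suc n *_) (fallingFactorial*[n∸k]!≡n! k≤n) ⟩
  suc n * n !                                ∎
  where open ≡-Reasoning

fallingFactorial≡n!/[n∸k]! : k ≤ n → fallingFactorial n k ≡ (n ! / (n ∸ k) !) {{(n ∸ k) !≢0}}
fallingFactorial≡n!/[n∸k]! {k} {n} k≤n = begin
  fallingFactorial n k                         ≡⟨ m*n/n≡m (fallingFactorial n k) ((n ∸ k) !) ⟨
  fallingFactorial n k * (n ∸ k) ! / (n ∸ k) ! ≡⟨ cong (_/ (n ∸ k) !) (fallingFactorial*[n∸k]!≡n! k≤n) ⟩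
  n ! / (n ∸ k) !                              ∎
  where
  open ≡-Reasoning
  instance _ = (n ∸ k) !≢0

module _ {x : Fin (suc n)} where

  punchOutAll : {v : Vec (Fin (suc n)) m} → All (x ≢_) v → Vec (Fin n) m
  punchOutAll []          = []
  punchOutAll (x≢y ∷ x≢v) = punchOut x≢y ∷ punchOutAll x≢v

  punchOutAll-≢ : {y : Fin (suc n)} {v : Vec (Fin (suc n)) m} (x≢y : x ≢ y) →
                  All (y ≢_) v → (x≢v : All (x ≢_) v) → All (punchOut x≢y ≢_) (punchOutAll x≢v)
  punchOutAll-≢ x≢y []          []          = []
  punchOutAll-≢ x≢y (y≢z ∷ y≢v) (x≢z ∷ x≢v) =
    (λ eq → y≢z (punchOut-injective x≢y x≢z eq)) ∷ punchOutAll-≢ x≢y y≢v x≢v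

  punchOutAll-unique : {v : Vec (Fin (suc n)) m} (x≢v : All (x ≢_) v) →
                       Unique v → Unique (punchOutAll x≢v)
  punchOutAll-unique []          []                 = []
  punchOutAll-unique (x≢y ∷ x≢v) (y≢v ∷ v-unique) =
    punchOutAll-≢ x≢y y≢v x≢v ∷ punchOutAll-unique x≢v v-unique

  punchOutAll-injective : {v w : Vec (Fin (suc n)) m} (x≢v : All (x ≢_) v) (x≢w : All (x ≢_) w) →
                          punchOutAll x≢v ≡ punchOutAll x≢w → v ≡ w
  punchOutAll-injective []          []          _  = refl
  punchOutAll-injective (x≢y ∷ x≢v) (x≢z ∷ x≢w) eq =
    cong₂ _∷_ (punchOut-injective x≢y x≢z (∷-injectiveˡ eq))
              (punchOutAll-injective x≢v x≢w (∷-injectiveʳ eq))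

encode : (v : Vec (Fin n) k) → Unique v → Fin (fallingFactorial n k)
encode             []      []                = zero
encode {n = suc n} (x ∷ v) (x≢v ∷ v-unique) =
  combine x (encode (punchOutAll x≢v) (punchOutAll-unique x≢v v-unique))

encode-injective : {v w : Vec (Fin n) k} (v-unique : Unique v) (w-unique : Unique w) →
                   encode v v-unique ≡ encode w w-unique → v ≡ w
encode-injective                         []         []         _  = refl
encode-injective {n = suc n} {v = x ∷ v} {y ∷ w} (x≢v ∷ v-unique) (y≢w ∷ w-unique) eq
  with combine-injective x _ y _ eq
... | refl , eq′ = cong (x ∷_) (punchOutAll-injective x≢v y≢w
                      (encode-injective (punchOutAll-unique x≢v v-unique) (punchOutAll-unique y≢w w-unique) eq′))

lookup-injective : {xs : List A} → ListUnique.Unique xs →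
                   ∀ i j → List.lookup xs i ≡ List.lookup xs j → i ≡ j
lookup-injective (_    ∷ _)         zero    zero    _  = refl
lookup-injective (x≢xs ∷ _)         zero    (suc j) eq = contradiction eq       (ListAll.lookup x≢xs (∈ₗ-lookup j))
lookup-injective (x≢xs ∷ _)         (suc i) zero    eq = contradiction (sym eq) (ListAll.lookup x≢xs (∈ₗ-lookup i))
lookup-injective (_    ∷ xs-unique) (suc i) (suc j) eq = cong suc (lookup-injective xs-unique i j eq)

MinDistGt-KDistLe⇒≡ : (𝒞 : Code n) {B : ℕ} → MinDistGt 𝒞 B → {σ τ : Vec (Fin n) n} →
                      σ ∈ₗ words 𝒞 → τ ∈ₗ words 𝒞 → KDistLe σ τ B → σ ≡ τ
MinDistGt-KDistLe⇒≡ 𝒞 md {σ} {τ} σ∈𝒞 τ∈𝒞 close with ≡-dec _≟_ σ τ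
... | yes σ≡τ = σ≡τ
... | no  σ≢τ = contradiction (md σ τ σ∈𝒞 τ∈𝒞 σ≢τ) (KDistLe⇒¬KDistGt close)

card≤fallingFactorial : (t : ℕ) (𝒞 : Code (t + m)) → MinDistGt 𝒞 (t C 2) →
                        card 𝒞 ≤ fallingFactorial (t + m) m
card≤fallingFactorial {m} t 𝒞 md = injective⇒≤ {f = suffix} suffix-injective
  where
  σ : Fin (card 𝒞) → Vec (Fin (t + m)) (t + m)
  σ i = List.lookup (words 𝒞) i
  σ-perm : ∀ i → IsPerm (σ i)
  σ-perm i = allPerm 𝒞 (σ i) (∈ₗ-lookup i)
  suffix : Fin (card 𝒞) → Fin (fallingFactorial (t + m) m)
  suffix i = encode (drop t (σ i)) (drop⁺ t (isPerm⇒unique (σ-perm i)))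
  suffix-injective : Injective _≡_ _≡_ suffix
  suffix-injective {i} {j} eq =
    lookup-injective (distinct 𝒞) i j
      (MinDistGt-KDistLe⇒≡ 𝒞 md (∈ₗ-lookup i) (∈ₗ-lookup j)
        (sameSuffix⇒KDistLe t (σ-perm i) (σ-perm j) (encode-injective _ _ eq)))

theorem3p8 : (n : ℕ) (𝒞 : Code n) (t : ℕ) → 1 ≤ t → t ≤ n →
    MinDistGt 𝒞 (t C 2) → card 𝒞 ≤ (n ! / t !) {{t !≢0}}
theorem3p8 n 𝒞 t _ t≤n md with m≤n⇒∃[o]m+o≡n t≤n
... | m , refl = begin
  card 𝒞                                          ≤⟨ card≤fallingFactorial t 𝒞 md ⟩
  fallingFactorial (t + m) m                      ≡⟨ fallingFactorial≡n!/[n∸k]! (m≤n+m m t) ⟩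
  ((t + m) ! / (t + m ∸ m) !) {{(t + m ∸ m) !≢0}} ≡⟨ cong (λ s → ((t + m) ! / s !) {{s !≢0}}) (m+n∸n≡m t m) ⟩
  ((t + m) ! / t !) {{t !≢0}}                     ∎
  where open ≤-Reasoning
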